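{- For $n\geq 3$, the number of permutations $\pi\in\mathcal{S}_n$ such that $\pi^2$ has exactly one descent is at least \[\sum_{k=2}^{n-1} 2\left\lfloor\frac{k}{2}\right\rfloor (n-k)\, e_{n-(k+1)},\] where $e_j$ denotes the number of involutions in $\mathcal{S}_j$ (with $e_0=1$).
   Context: $\mathcal{S}_n$ is the symmetric group on $[n]$; a permutation $\sigma=\sigma_1\cdots\sigma_n$ (one-line notation) has a descent at position $i\in[n-1]$ if $\sigma_i>\sigma_{i+1}$. $\pi^2(j)=\pi(\pi(j))$. An involution is a permutation $\tau$ with $\tau^2$ the identity. -}

module Defs where

open import Data.Nat using (ℕ; zero; suc; _+_; _*_; _∸_; _/_; _<ᵇ_; _≡ᵇ_)
open import Data.Bool using (Bool; true; false; if_then_else_; _∧_; not)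
open import Data.Fin using (Fin; toℕ)
open import Data.Fin.Properties using (_≟_)
open import Data.Vec using (Vec; []; _∷_; lookup; tabulate; toList)
open import Data.List using (List; []; _∷_; length; filter; map; concatMap; allFin; upTo)
open import Data.Bool.ListAction using (and)
open import Data.Nat.ListAction using (sum)
open import Relation.Nullary.Decidable using (⌊_⌋)
open import Relation.Unary using (Decidable)
open import Relation.Binary.PropositionalEquality using (_≡_)

allVecs : (m n : ℕ) → List (Vec (Fin n) m)
allVecs zero    n = [] ∷ []
allVecs (suc m) n = concatMap (λ x → map (x ∷_) (allVecs m n)) (allFin n)

-- A one-line word w : [n] → [n] is a permutation iff its entries are pairwise
-- distinct (injective self-map of a finite set).
distinctᵇ : {n : ℕ} → List (Fin n) → Bool
distinctᵇ []       = true
distinctᵇ (x ∷ xs) = and (map (λ y → not ⌊ x ≟ y ⌋) xs) ∧ distinctᵇ xs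

isPermᵇ : {n : ℕ} → Vec (Fin n) n → Bool
isPermᵇ v = distinctᵇ (toList v)

Perms : (n : ℕ) → List (Vec (Fin n) n)
Perms n = filter (λ v → isPermᵇ v ≡? true) (allVecs n n)
  where
  open import Data.Bool.Properties using () renaming (_≟_ to _≡?_)

square : {n : ℕ} → Vec (Fin n) n → Vec (Fin n) n
square v = tabulate (λ i → lookup v (lookup v i))

descents : {n : ℕ} → List (Fin n) → ℕ
descents []           = 0
descents (x ∷ [])     = 0
descents (x ∷ y ∷ xs) = (if toℕ y <ᵇ toℕ x then 1 else 0) + descents (y ∷ xs)

isInvolutionᵇ : {n : ℕ} → Vec (Fin n) n → Bool
isInvolutionᵇ v = and (map (λ i → ⌊ lookup v (lookup v i) ≟ i ⌋) (allFin _))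

countSqOneDescent : ℕ → ℕ
countSqOneDescent n =
  length (filter (λ v → descents (toList (square v)) ≟ℕ 1) (Perms n))
  where
  open import Data.Nat.Properties using () renaming (_≟_ to _≟ℕ_)

involutions : ℕ → ℕ
involutions j = length (filter (λ v → isInvolutionᵇ v ≟B true) (Perms j))
  where
  open import Data.Bool.Properties using () renaming (_≟_ to _≟B_)

lowerBound : ℕ → ℕ
lowerBound n = sum (map term (map (λ i → i + 2) (upTo (n ∸ 2))))
  where
  term : ℕ → ℕ
  term k = 2 * (k / 2) * (n ∸ k) * involutions (n ∸ (k + 1))

-- For 2 ≤ k ≤ n - 1 take a block [a, a + k] of k + 1 consecutive positions, an involution τ of
-- the other n - k - 1 positions (relabelled monotonically) and a rotation of the block by r with
-- 2r ≢ 0 (mod k + 1). The permutation π acting as τ outside and as the rotation on the block has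
-- π² = identity outside the block and rotation by 2r on it, whose one-line form has exactly one
-- descent. The points moved by π² are exactly the block, so π² determines a and k, after which
-- π determines r and τ. There are n - k choices of a, 2⌊k/2⌋ of r and e_{n-k-1} of τ.

{-# OPTIONS --safe #-}
module Submission where

open import Defs
open import Data.Nat using (ℕ; _≤_)

open import Data.Nat
  using (zero; suc; _+_; _*_; _∸_; _%_; _/_; pred; _<_; _<ᵇ_; NonZero; z≤n; s≤s; z<s; s<s; s≤s⁻¹; >-nonZero)
open import Data.Nat.Properties
open import Data.Nat.DivMod
  using (m%n<n; %-distribˡ-+; m%n%n≡m%n; m<n⇒m%n≡m; n%n≡0; m≤n⇒[n∸m]%m≡n%m; m/n≤m; m/n*n≤m)
open import Data.Nat.ListAction using (sum)
open import Data.Nat.Solver using (module +-*-Solver)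
open import Data.Bool using (true; T; if_then_else_)
open import Data.Bool.Properties using (T-∧; T-≡) renaming (_≟_ to _≟ᵇ_)
open import Data.Fin as Fin using (Fin; toℕ; fromℕ<)
open import Data.Fin.Properties using (toℕ-fromℕ<; toℕ-injective; toℕ<n)
open import Data.Vec using (Vec; []; _∷_; lookup; toList; tabulate)
open import Data.Vec.Properties using (∷-injectiveʳ; lookup∘tabulate)
open import Data.List as List using (List; []; _∷_; _++_; length; map; concatMap; filter; allFin; upTo)
open import Data.List.Properties using (length-++; length-map; length-upTo; map-cong)
open import Data.List.Membership.Propositional using (_∈_; find)
open import Data.List.Membership.Propositional.Properties
  using (∈-concatMap⁺; ∈-concatMap⁻; ∈-map⁺; ∈-map⁻; ∈-++⁻; ∈-upTo⁻; ∈-allFin)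
  using (∈-filter⁺; ∈-filter⁻)
open import Data.List.Relation.Binary.Subset.Propositional using (_⊆_)
import Data.List.Relation.Unary.All as All
open import Data.List.Relation.Unary.All.Properties using (all⁺; all⁻)
open import Data.List.Relation.Unary.Any as Any using (here; there)
open import Data.List.Relation.Unary.Unique.Propositional using (Unique; []; _∷_)
import Data.List.Relation.Unary.Unique.Propositional.Properties as Unique
open import Data.Product using (Σ-syntax; ∃-syntax; _×_; _,_; proj₁; proj₂)
open import Data.Sum using (inj₁; inj₂)
open import Function using (id; _∘_; Equivalence)
open import Relation.Binary.PropositionalEquality
open import Relation.Nullary using (¬_; yes; no; contradiction)
open import Relation.Nullary.Decidable using (dec-true; dec-false; toWitness; fromWitnessFalse)

private variable
  A B : Set

remove-∈ : {x : A} {ys : List A} → x ∈ ys →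
  ∃[ zs ] length ys ≡ suc (length zs) × (∀ {y} → y ∈ ys → y ≢ x → y ∈ zs)
remove-∈ {ys = _ ∷ zs} (here refl) = zs , refl , λ where
  (here y≡x) y≢x → contradiction y≡x y≢x
  (there y∈) _   → y∈
remove-∈ {ys = z ∷ _} (there x∈) with remove-∈ x∈
... | zs , len , keep = z ∷ zs , cong suc len , λ where
  (here y≡z) _   → here y≡z
  (there y∈) y≢x → there (keep y∈ y≢x)

Unique⇒length≤ : {xs ys : List A} → Unique xs → xs ⊆ ys → length xs ≤ length ys
Unique⇒length≤ {xs = []}     _            _     = z≤n
Unique⇒length≤ {xs = x ∷ xs} (x∉xs ∷ !xs) xs⊆ys with remove-∈ (xs⊆ys (here refl))
... | zs , len , keep = subst (suc (length xs) ≤_) (sym len)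
  (s≤s (Unique⇒length≤ !xs λ y∈xs → keep (xs⊆ys (there y∈xs)) λ { refl → All.lookup x∉xs y∈xs refl }))

Unique-concatMap : (f : A → List B) {xs : List A} → Unique xs →
  (∀ {x} → x ∈ xs → Unique (f x)) →
  (∀ {x y b} → x ∈ xs → y ∈ xs → b ∈ f x → b ∈ f y → x ≡ y) →
  Unique (concatMap f xs)
Unique-concatMap f {[]}     _            _  _   = []
Unique-concatMap f {x ∷ xs} (x∉xs ∷ !xs) !f det =
  Unique.++⁺ (!f (here refl)) (Unique-concatMap f !xs (!f ∘ there) (λ p q → det (there p) (there q))) disjoint
  where
  disjoint : ∀ {b} → ¬ (b ∈ f x × b ∈ concatMap f xs)
  disjoint (b∈fx , b∈fxs) with find (∈-concatMap⁻ f {xs = xs} b∈fxs)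
  ... | y , y∈xs , b∈fy = All.lookup x∉xs y∈xs (det (here refl) (there y∈xs) b∈fx b∈fy)

length-concatMap : (f : A → List B) (xs : List A) → length (concatMap f xs) ≡ sum (map (length ∘ f) xs)
length-concatMap f []       = refl
length-concatMap f (x ∷ xs) = trans (length-++ (f x)) (cong (length (f x) +_) (length-concatMap f xs))

length-concatMap-const : (f : A → List B) (xs : List A) {c : ℕ} → (∀ x → length (f x) ≡ c) →
  length (concatMap f xs) ≡ length xs * c
length-concatMap-const f []       _   = refl
length-concatMap-const f (x ∷ xs) len =
  trans (length-++ (f x)) (cong₂ _+_ (len x) (length-concatMap-const f xs len))

∈-allVecs : ∀ {m n} (v : Vec (Fin n) m) → v ∈ allVecs m n
∈-allVecs []              = here refl
∈-allVecs {n = n} (x ∷ v) = ∈-concatMap⁺ (λ y → map (y ∷_) (allVecs _ n)) {xs = allFin n}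
  (Any.map (λ { refl → ∈-map⁺ (x ∷_) (∈-allVecs v) }) (∈-allFin x))

allVecs-Unique : ∀ m n → Unique (allVecs m n)
allVecs-Unique zero    n = All.[] ∷ []
allVecs-Unique (suc m) n = Unique-concatMap _ (Unique.allFin⁺ n)
  (λ _ → Unique.map⁺ ∷-injectiveʳ (allVecs-Unique m n)) same-head
  where
  same-head : ∀ {x y v} → x ∈ allFin n → y ∈ allFin n →
    v ∈ map (x ∷_) (allVecs m n) → v ∈ map (y ∷_) (allVecs m n) → x ≡ y
  same-head _ _ p q with ∈-map⁻ _ p | ∈-map⁻ _ q
  ... | _ , _ , refl | _ , _ , refl = refl

Unique⇒distinctᵇ : ∀ {n} {xs : List (Fin n)} → Unique xs → T (distinctᵇ xs)
Unique⇒distinctᵇ []           = _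
Unique⇒distinctᵇ (x∉xs ∷ !xs) =
  Equivalence.from T-∧ (all⁻ _ (All.map fromWitnessFalse x∉xs) , Unique⇒distinctᵇ !xs)

∈-Perms : ∀ {n} {v : Vec (Fin n) n} → Unique (toList v) → v ∈ Perms n
∈-Perms {v = v} !v = ∈-filter⁺ _ (∈-allVecs v) (Equivalence.to T-≡ (Unique⇒distinctᵇ !v))

Perms-Unique : ∀ n → Unique (Perms n)
Perms-Unique n = Unique.filter⁺ _ (allVecs-Unique n n)

Involutions : (j : ℕ) → List (Vec (Fin j) j)
Involutions j = filter (λ v → isInvolutionᵇ v ≟ᵇ true) (Perms j)

Involutions-Unique : ∀ j → Unique (Involutions j)
Involutions-Unique j = Unique.filter⁺ _ (Perms-Unique j)

∈-Involutions⇒involutive : ∀ {j} {τ : Vec (Fin j) j} → τ ∈ Involutions j → ∀ i → lookup τ (lookup τ i) ≡ i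
∈-Involutions⇒involutive {j} {τ} τ∈ i = toWitness (All.lookup
  (all⁺ _ (allFin j) (Equivalence.from T-≡ (proj₂ (∈-filter⁻ _ {xs = Perms j} τ∈)))) (∈-allFin i))

SqOneDescent : (n : ℕ) → List (Vec (Fin n) n)
SqOneDescent n = filter (λ v → descents (toList (square v)) ≟ 1) (Perms n)

if-<ᵇ-< : ∀ {x y} {t e : A} → x < y → (if x <ᵇ y then t else e) ≡ t
if-<ᵇ-< {x = x} {y} {t} {e} x<y = cong (if_then t else e) (dec-true (x <? y) x<y)

if-<ᵇ-≥ : ∀ {x y} {t e : A} → y ≤ x → (if x <ᵇ y then t else e) ≡ e
if-<ᵇ-≥ {x = x} {y} {t} {e} y≤x = cong (if_then t else e) (dec-false (x <? y) (≤⇒≯ y≤x))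

descentsUpTo : (ℕ → ℕ) → ℕ → ℕ
descentsUpTo g zero    = 0
descentsUpTo g (suc l) = (if g 1 <ᵇ g 0 then 1 else 0) + descentsUpTo (g ∘ suc) l

descents-tabulate : ∀ {m} n (f : Fin n → Fin m) (g : ℕ → ℕ) → (∀ i → toℕ (f i) ≡ g (toℕ i)) →
  descents (toList (tabulate f)) ≡ descentsUpTo g (pred n)
descents-tabulate zero          f g f≗g = refl
descents-tabulate (suc zero)    f g f≗g = refl
descents-tabulate (suc (suc n)) f g f≗g =
  cong₂ _+_ (cong₂ (λ x y → if x <ᵇ y then 1 else 0) (f≗g (Fin.suc Fin.zero)) (f≗g Fin.zero))
            (descents-tabulate (suc n) (f ∘ Fin.suc) (g ∘ suc) (f≗g ∘ Fin.suc))

descentsUpTo-cong : ∀ {g h} len → (∀ {i} → i ≤ len → g i ≡ h i) → descentsUpTo g len ≡ descentsUpTo h len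
descentsUpTo-cong zero    _   = refl
descentsUpTo-cong (suc l) g≗h = cong₂ _+_ (cong₂ (λ x y → if x <ᵇ y then 1 else 0) (g≗h (s≤s z≤n)) (g≗h z≤n))
                                          (descentsUpTo-cong l (g≗h ∘ s≤s))

descentsUpTo-≡0 : ∀ g len → (∀ i → i < len → g i < g (suc i)) → descentsUpTo g len ≡ 0
descentsUpTo-≡0 g zero    _   = refl
descentsUpTo-≡0 g (suc l) asc =
  cong₂ _+_ (if-<ᵇ-≥ (<⇒≤ (asc 0 z<s))) (descentsUpTo-≡0 (g ∘ suc) l λ i i<l → asc (suc i) (s<s i<l))

descentsUpTo-≡1 : ∀ g len p → p < len → g (suc p) < g p →
  (∀ i → i < len → i ≢ p → g i < g (suc i)) → descentsUpTo g len ≡ 1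
descentsUpTo-≡1 g (suc l) zero    _         desc asc =
  cong₂ _+_ (if-<ᵇ-< desc) (descentsUpTo-≡0 (g ∘ suc) l λ i i<l → asc (suc i) (s<s i<l) λ ())
descentsUpTo-≡1 g (suc l) (suc p) (s<s p<l) desc asc =
  cong₂ _+_ (if-<ᵇ-≥ (<⇒≤ (asc 0 z<s λ ())))
            (descentsUpTo-≡1 (g ∘ suc) l p p<l desc λ i i<l i≢p → asc (suc i) (s<s i<l) (i≢p ∘ suc-injective))

MapsBelow : ℕ → (ℕ → ℕ) → Set
MapsBelow n f = ∀ {x} → x < n → f x < n

-- The fallback i is a junk value: fromFunction n f is only used for f with MapsBelow n f.
clamp : ∀ {n} → ℕ → Fin n → Fin n
clamp {n} x i with x <? n
... | yes x<n = fromℕ< x<n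
... | no  _   = i

toℕ-clamp : ∀ {n x} (i : Fin n) → x < n → toℕ (clamp x i) ≡ x
toℕ-clamp {n} {x} i x<n with x <? n
... | yes x<n′ = toℕ-fromℕ< x<n′
... | no  x≮n  = contradiction x<n x≮n

fromFunction : (n : ℕ) → (ℕ → ℕ) → Vec (Fin n) n
fromFunction n f = tabulate (λ i → clamp (f (toℕ i)) i)

module _ {n : ℕ} {f : ℕ → ℕ} (f<n : MapsBelow n f) where

  toℕ-lookup-fromFunction : ∀ i → toℕ (lookup (fromFunction n f) i) ≡ f (toℕ i)
  toℕ-lookup-fromFunction i = trans (cong toℕ (lookup∘tabulate _ i)) (toℕ-clamp i (f<n (toℕ<n i)))

  fromFunction-Unique : (∀ {x y} → x < n → y < n → f x ≡ f y → x ≡ y) → Unique (toList (fromFunction n f))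
  fromFunction-Unique f-inj = subst Unique (sym (toList-tabulate _)) (Unique.tabulate⁺ λ {i} {i′} eq →
    toℕ-injective (f-inj (toℕ<n i) (toℕ<n i′)
      (trans (sym (toℕ-clamp i (f<n (toℕ<n i)))) (trans (cong toℕ eq) (toℕ-clamp i′ (f<n (toℕ<n i′)))))))
    where
    toList-tabulate : ∀ {m} (h : Fin m → Fin n) → toList (tabulate h) ≡ List.tabulate h
    toList-tabulate {zero}  h = refl
    toList-tabulate {suc m} h = cong (h Fin.zero ∷_) (toList-tabulate (h ∘ Fin.suc))

  descents-square-fromFunction : descents (toList (square (fromFunction n f))) ≡ descentsUpTo (f ∘ f) (pred n)
  descents-square-fromFunction = descents-tabulate n (λ i → lookup v (lookup v i)) (f ∘ f) λ i →
    trans (toℕ-lookup-fromFunction (lookup v i)) (cong f (toℕ-lookup-fromFunction i))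
    where v = fromFunction n f

fromFunction-injective : ∀ {n} {f g : ℕ → ℕ} → MapsBelow n f → MapsBelow n g →
  fromFunction n f ≡ fromFunction n g → ∀ {x} → x < n → f x ≡ g x
fromFunction-injective {n} {f} {g} f<n g<n eq {x} x<n = at (fromℕ< x<n) (toℕ-fromℕ< x<n)
  where
  at : (i : Fin n) → toℕ i ≡ x → f x ≡ g x
  at i refl = trans (sym (toℕ-lookup-fromFunction f<n i))
    (trans (cong (λ v → toℕ (lookup v i)) eq) (toℕ-lookup-fromFunction g<n i))

-- The junk value 0 outside [0, l) is never used.
lookupℕ : ∀ {m l} → Vec (Fin m) l → ℕ → ℕ
lookupℕ []      _       = 0
lookupℕ (x ∷ _) zero    = toℕ x
lookupℕ (_ ∷ v) (suc y) = lookupℕ v y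

lookupℕ-toℕ : ∀ {m l} (v : Vec (Fin m) l) i → lookupℕ v (toℕ i) ≡ toℕ (lookup v i)
lookupℕ-toℕ (x ∷ _) Fin.zero    = refl
lookupℕ-toℕ (_ ∷ v) (Fin.suc i) = lookupℕ-toℕ v i

lookupℕ-< : ∀ {m l} (v : Vec (Fin m) l) {y} → y < l → lookupℕ v y < m
lookupℕ-< (x ∷ _) {zero}  _         = toℕ<n x
lookupℕ-< (_ ∷ v) {suc y} (s<s y<l) = lookupℕ-< v y<l

lookupℕ-injective : ∀ {m l} (v w : Vec (Fin m) l) → (∀ {y} → y < l → lookupℕ v y ≡ lookupℕ w y) → v ≡ w
lookupℕ-injective []      []      _  = refl
lookupℕ-injective (x ∷ v) (y ∷ w) eq =
  cong₂ _∷_ (toℕ-injective (eq z<s)) (lookupℕ-injective v w λ y<l → eq (s<s y<l))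

InvolutiveBelow : ℕ → (ℕ → ℕ) → Set
InvolutiveBelow j T = ∀ {y} → y < j → T (T y) ≡ y

lookupℕ-involutive : ∀ {l} (τ : Vec (Fin l) l) → (∀ i → lookup τ (lookup τ i) ≡ i) →
  InvolutiveBelow l (lookupℕ τ)
lookupℕ-involutive {l} τ τ²≡id {y} y<l = at (fromℕ< y<l) (toℕ-fromℕ< y<l)
  where
  at : (i : Fin l) → toℕ i ≡ y → lookupℕ τ (lookupℕ τ y) ≡ y
  at i refl = begin
    lookupℕ τ (lookupℕ τ (toℕ i))  ≡⟨ cong (lookupℕ τ) (lookupℕ-toℕ τ i) ⟩
    lookupℕ τ (toℕ (lookup τ i))   ≡⟨ lookupℕ-toℕ τ (lookup τ i) ⟩
    toℕ (lookup τ (lookup τ i))    ≡⟨ cong toℕ (τ²≡id i) ⟩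
    toℕ i                          ∎
    where open ≡-Reasoning

-- Rotations of {0, …, k}

[m%n+o]%n≡[m+o]%n : ∀ m o n .{{_ : NonZero n}} → (m % n + o) % n ≡ (m + o) % n
[m%n+o]%n≡[m+o]%n m o n = begin
  (m % n + o) % n          ≡⟨ %-distribˡ-+ (m % n) o n ⟩
  (m % n % n + o % n) % n  ≡⟨ cong (λ x → (x + o % n) % n) (m%n%n≡m%n m n) ⟩
  (m % n + o % n) % n      ≡⟨ %-distribˡ-+ m o n ⟨
  (m + o) % n              ∎
  where open ≡-Reasoning

rotate : ℕ → ℕ → ℕ → ℕ
rotate k r d = (d + r) % suc k

module _ (k : ℕ) where

  private
    L = suc k

  rotate-< : ∀ r d → rotate k r d < L
  rotate-< r d = m%n<n (d + r) L

  rotate-∘ : ∀ s r d → rotate k s (rotate k r d) ≡ rotate k (rotate k s r) d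
  rotate-∘ s r d = begin
    ((d + r) % L + s) % L  ≡⟨ [m%n+o]%n≡[m+o]%n (d + r) s L ⟩
    (d + r + s) % L        ≡⟨ cong (_% L) (trans (+-assoc d r s) (+-comm d (r + s))) ⟩
    (r + s + d) % L        ≡⟨ [m%n+o]%n≡[m+o]%n (r + s) d L ⟨
    ((r + s) % L + d) % L  ≡⟨ cong (_% L) (+-comm _ d) ⟩
    (d + (r + s) % L) % L  ∎
    where open ≡-Reasoning

  rotate-small : ∀ r d → d + r < L → rotate k r d ≡ d + r
  rotate-small r d = m<n⇒m%n≡m

  rotate-wrap : ∀ r d → L ≤ d + r → d + r < L + L → rotate k r d ≡ d + r ∸ L
  rotate-wrap r d L≤d+r d+r<2L = trans (sym (m≤n⇒[n∸m]%m≡n%m L≤d+r))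
    (m<n⇒m%n≡m (subst (d + r ∸ L <_) (m+n∸n≡m L L) (∸-monoˡ-< d+r<2L L≤d+r)))

  rotate-identity : ∀ {d} → d < L → rotate k 0 d ≡ d
  rotate-identity {d} d<L = trans (cong (_% L) (+-identityʳ d)) (m<n⇒m%n≡m d<L)

  rotate-inverse : ∀ {r} → r ≤ L → rotate k (L ∸ r) r ≡ 0
  rotate-inverse r≤L = trans (cong (_% L) (m+[n∸m]≡n r≤L)) (n%n≡0 L)

  rotate-injective : ∀ {r d d′} → r ≤ L → d < L → d′ < L → rotate k r d ≡ rotate k r d′ → d ≡ d′
  rotate-injective {r} {d} {d′} r≤L d<L d′<L eq = begin
    d                                 ≡⟨ unrotate d<L ⟨
    rotate k (L ∸ r) (rotate k r d)   ≡⟨ cong (rotate k (L ∸ r)) eq ⟩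
    rotate k (L ∸ r) (rotate k r d′)  ≡⟨ unrotate d′<L ⟩
    d′                                ∎
    where
    open ≡-Reasoning
    unrotate : ∀ {x} → x < L → rotate k (L ∸ r) (rotate k r x) ≡ x
    unrotate {x} x<L = trans (rotate-∘ (L ∸ r) r x)
      (trans (cong (λ s → rotate k s x) (rotate-inverse r≤L)) (rotate-identity x<L))

  rotate-fixed : ∀ {u d} → u < L → d < L → rotate k u d ≡ d → u ≡ 0
  rotate-fixed {u} {d} u<L d<L fixed = rotate-injective (<⇒≤ d<L) u<L z<s (begin
    rotate k d u  ≡⟨ cong (_% L) (+-comm u d) ⟩
    rotate k u d  ≡⟨ fixed ⟩
    d             ≡⟨ m<n⇒m%n≡m d<L ⟨
    rotate k d 0  ∎)
    where open ≡-Reasoning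

  rotate-suc : ∀ r d → rotate k r d ≢ k → rotate k r (suc d) ≡ suc (rotate k r d)
  rotate-suc r d ≢k = begin
    suc (d + r) % L        ≡⟨ cong (_% L) (+-comm 1 (d + r)) ⟩
    (d + r + 1) % L        ≡⟨ [m%n+o]%n≡[m+o]%n (d + r) 1 L ⟨
    ((d + r) % L + 1) % L  ≡⟨ cong (_% L) (+-comm _ 1) ⟩
    suc ((d + r) % L) % L  ≡⟨ m<n⇒m%n≡m (s<s (≤∧≢⇒< (<⇒≤pred (rotate-< r d)) ≢k)) ⟩
    suc ((d + r) % L)      ∎
    where open ≡-Reasoning

  rotate-last : ∀ {u} → u ≤ k → rotate k u (k ∸ u) ≡ k
  rotate-last u≤k = trans (cong (_% L) (m∸n+n≡m u≤k)) (m<n⇒m%n≡m (n<1+n k))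

  rotate-after-last : ∀ {u} → u ≤ k → rotate k u (suc (k ∸ u)) ≡ 0
  rotate-after-last u≤k = trans (cong (λ x → suc x % L) (m∸n+n≡m u≤k)) (n%n≡0 L)

  rotate-twice-nonzero : ∀ {r} → 0 < r → r < L → r + r ≢ L → 0 < rotate k r r
  rotate-twice-nonzero {r} 0<r r<L 2r≢L with r + r <? L
  ... | yes 2r<L = subst (0 <_) (sym (rotate-small r r 2r<L)) (<-≤-trans 0<r (m≤m+n r r))
  ... | no  2r≮L = subst (0 <_) (sym (rotate-wrap r r (≮⇒≥ 2r≮L) (+-mono-< r<L r<L)))
                     (m<n⇒0<n∸m (≤∧≢⇒< (≮⇒≥ 2r≮L) (2r≢L ∘ sym)))

-- Splicing a rotated block into a permutation

module Splice (a k : ℕ) where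

  private
    L = suc k

  skip : ℕ → ℕ
  skip y = if y <ᵇ a then y else y + L

  unskip : ℕ → ℕ
  unskip x = if x <ᵇ a then x else x ∸ L

  -- T, relabelled by skip onto the complement of the block [a, a + k], on which r acts as a rotation.
  splice : (ℕ → ℕ) → ℕ → ℕ → ℕ
  splice T r x =
    if x <ᵇ a then skip (T x)
    else if x <ᵇ a + L then a + rotate k r (x ∸ a)
    else skip (T (x ∸ L))

  blockRotation : ℕ → ℕ → ℕ
  blockRotation = splice id

  skip-below : ∀ {y} → y < a → skip y ≡ y
  skip-below = if-<ᵇ-<

  skip-above : ∀ {y} → a ≤ y → skip y ≡ y + L
  skip-above = if-<ᵇ-≥

  skip-∸ : ∀ {x} → a + L ≤ x → skip (x ∸ L) ≡ x
  skip-∸ {x} a+L≤x = trans (skip-above (subst (_≤ x ∸ L) (m+n∸n≡m a L) (∸-monoˡ-≤ L a+L≤x)))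
                            (m∸n+n≡m (≤-trans (m≤n+m L a) a+L≤x))

  unskip-skip : ∀ y → unskip (skip y) ≡ y
  unskip-skip y with y <? a
  ... | yes y<a = trans (cong unskip (skip-below y<a)) (if-<ᵇ-< y<a)
  ... | no  y≮a = trans (cong unskip (skip-above (≮⇒≥ y≮a)))
                    (trans (if-<ᵇ-≥ (≤-trans (≮⇒≥ y≮a) (m≤m+n y L))) (m+n∸n≡m y L))

  skip-injective : ∀ {y y′} → skip y ≡ skip y′ → y ≡ y′
  skip-injective {y} {y′} eq = trans (sym (unskip-skip y)) (trans (cong unskip eq) (unskip-skip y′))

  splice-skip : ∀ T r y → splice T r (skip y) ≡ skip (T y)
  splice-skip T r y with y <? a
  ... | yes y<a = trans (cong (splice T r) (skip-below y<a)) (if-<ᵇ-< y<a)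
  ... | no  y≮a = begin
    splice T r (skip y)   ≡⟨ cong (splice T r) (skip-above a≤y) ⟩
    splice T r (y + L)    ≡⟨ if-<ᵇ-≥ (≤-trans a≤y (m≤m+n y L)) ⟩
    _                     ≡⟨ if-<ᵇ-≥ (+-monoˡ-≤ L a≤y) ⟩
    skip (T (y + L ∸ L))  ≡⟨ cong (skip ∘ T) (m+n∸n≡m y L) ⟩
    skip (T y)            ∎
    where
    open ≡-Reasoning
    a≤y = ≮⇒≥ y≮a

  splice-block : ∀ T r {d} → d < L → splice T r (a + d) ≡ a + rotate k r d
  splice-block T r {d} d<L = trans (if-<ᵇ-≥ (m≤m+n a d))
    (trans (if-<ᵇ-< (+-monoʳ-< a d<L)) (cong (λ x → a + rotate k r x) (m+n∸m≡n a d)))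

  data Position : ℕ → Set where
    outside : ∀ y → Position (skip y)
    inside  : ∀ {d} → d < L → Position (a + d)

  position : ∀ x → Position x
  position x with x <? a | x <? a + L
  ... | yes x<a | _         = subst Position (skip-below x<a) (outside x)
  ... | no  x≮a | yes x<a+L = subst Position (m+[n∸m]≡n (≮⇒≥ x≮a))
    (inside (subst (x ∸ a <_) (m+n∸m≡n a L) (∸-monoˡ-< x<a+L (≮⇒≥ x≮a))))
  ... | no  _   | no  x≮a+L = subst Position (skip-∸ (≮⇒≥ x≮a+L)) (outside (x ∸ L))

  splice-∘ : ∀ T S s r x → splice T s (splice S r x) ≡ splice (T ∘ S) (rotate k s r) x
  splice-∘ T S s r x with position x
  ... | outside y = begin
    splice T s (splice S r (skip y))  ≡⟨ cong (splice T s) (splice-skip S r y) ⟩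
    splice T s (skip (S y))           ≡⟨ splice-skip T s (S y) ⟩
    skip (T (S y))                    ≡⟨ splice-skip (T ∘ S) _ y ⟨
    splice (T ∘ S) _ (skip y)         ∎
    where open ≡-Reasoning
  ... | inside {d} d<L = begin
    splice T s (splice S r (a + d))   ≡⟨ cong (splice T s) (splice-block S r d<L) ⟩
    splice T s (a + rotate k r d)     ≡⟨ splice-block T s (rotate-< k r d) ⟩
    a + rotate k s (rotate k r d)     ≡⟨ cong (a +_) (rotate-∘ k s r d) ⟩
    a + rotate k (rotate k s r) d     ≡⟨ splice-block (T ∘ S) _ d<L ⟨
    splice (T ∘ S) _ (a + d)          ∎
    where open ≡-Reasoning

  blockRotation-skip : ∀ u y → blockRotation u (skip y) ≡ skip y
  blockRotation-skip = splice-skip id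

  blockRotation-block : ∀ u {d} → d < L → blockRotation u (a + d) ≡ a + rotate k u d
  blockRotation-block = splice-block id

  blockRotation-zero : ∀ x → blockRotation 0 x ≡ x
  blockRotation-zero x with position x
  ... | outside y  = blockRotation-skip 0 y
  ... | inside d<L = trans (blockRotation-block 0 d<L) (cong (a +_) (rotate-identity k d<L))

  blockRotation-below : ∀ u {x} → x < a → blockRotation u x ≡ x
  blockRotation-below u x<a = trans (if-<ᵇ-< x<a) (skip-below x<a)

  blockRotation-above : ∀ u {x} → a + L ≤ x → blockRotation u x ≡ x
  blockRotation-above u {x} a+L≤x =
    trans (if-<ᵇ-≥ (≤-trans (m≤m+n a L) a+L≤x)) (trans (if-<ᵇ-≥ a+L≤x) (skip-∸ a+L≤x))

  blockRotation-≥ : ∀ u {x} → a ≤ x → a ≤ blockRotation u x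
  blockRotation-≥ u {x} a≤x with position x
  ... | outside y      = subst (a ≤_) (sym (blockRotation-skip u y)) a≤x
  ... | inside {d} d<L = subst (a ≤_) (sym (blockRotation-block u d<L)) (m≤m+n a _)

  moved⇒inBlock : ∀ u {x} → blockRotation u x ≢ x → a ≤ x × x < a + L
  moved⇒inBlock u moved = ≮⇒≥ (moved ∘ blockRotation-below u) , ≰⇒> (moved ∘ blockRotation-above u)

  inBlock⇒moved : ∀ {u d} → 0 < u → u < L → d < L → blockRotation u (a + d) ≢ a + d
  inBlock⇒moved {u} 0<u u<L d<L fixed = <⇒≢ 0<u (sym (rotate-fixed k u<L d<L
    (+-cancelˡ-≡ a _ _ (trans (sym (blockRotation-block u d<L)) fixed))))

  descentPosition : ℕ → ℕ
  descentPosition u = a + (k ∸ u)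

  blockRotation-descent : ∀ {u} → 0 < u → u < L →
    blockRotation u (suc (descentPosition u)) < blockRotation u (descentPosition u)
  blockRotation-descent {u} 0<u u<L = begin-strict
    blockRotation u (suc (a + (k ∸ u)))  ≡⟨ cong (blockRotation u) (+-suc a (k ∸ u)) ⟨
    blockRotation u (a + suc (k ∸ u))    ≡⟨ blockRotation-block u (s<s (∸-monoʳ-< 0<u u≤k)) ⟩
    a + rotate k u (suc (k ∸ u))         ≡⟨ cong (a +_) (rotate-after-last k u≤k) ⟩
    a + 0                                <⟨ +-monoʳ-< a (<-≤-trans 0<u u≤k) ⟩
    a + k                                ≡⟨ cong (a +_) (rotate-last k u≤k) ⟨
    a + rotate k u (k ∸ u)               ≡⟨ blockRotation-block u (s<s (m∸n≤m k u)) ⟨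
    blockRotation u (a + (k ∸ u))        ∎
    where
    open ≤-Reasoning
    u≤k = s≤s⁻¹ u<L

  blockRotation-ascent-below : ∀ u {y} → y < a → blockRotation u y < blockRotation u (suc y)
  blockRotation-ascent-below u {y} y<a with suc y <? a
  ... | yes sy<a = subst₂ _<_ (sym (blockRotation-below u y<a)) (sym (blockRotation-below u sy<a)) (n<1+n y)
  ... | no  sy≮a = subst (_< blockRotation u (suc y)) (sym (blockRotation-below u y<a))
                     (<-≤-trans y<a (blockRotation-≥ u (≮⇒≥ sy≮a)))

  blockRotation-ascent-above : ∀ u {x} → a + L ≤ x → blockRotation u x < blockRotation u (suc x)
  blockRotation-ascent-above u a+L≤x = subst₂ _<_ (sym (blockRotation-above u a+L≤x))
    (sym (blockRotation-above u (m≤n⇒m≤1+n a+L≤x))) (n<1+n _)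

  blockRotation-ascent-block : ∀ {u d} → u < L → d < L → a + d ≢ descentPosition u →
    blockRotation u (a + d) < blockRotation u (suc (a + d))
  blockRotation-ascent-block {u} {d} u<L d<L i≢p with suc d <? L
  ... | yes sd<L = begin-strict
    blockRotation u (a + d)        ≡⟨ blockRotation-block u d<L ⟩
    a + rotate k u d               <⟨ +-monoʳ-< a (n<1+n _) ⟩
    a + suc (rotate k u d)         ≡⟨ cong (a +_) (rotate-suc k u d rot≢k) ⟨
    a + rotate k u (suc d)         ≡⟨ blockRotation-block u sd<L ⟨
    blockRotation u (a + suc d)    ≡⟨ cong (blockRotation u) (+-suc a d) ⟩
    blockRotation u (suc (a + d))  ∎
    where
    open ≤-Reasoning
    rot≢k : rotate k u d ≢ k
    rot≢k eq = i≢p (cong (a +_) (rotate-injective k (<⇒≤ u<L) d<L (s<s (m∸n≤m k u))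
      (trans eq (sym (rotate-last k (s≤s⁻¹ u<L))))))
  ... | no  sd≮L = begin-strict
    blockRotation u (a + d)        ≡⟨ blockRotation-block u d<L ⟩
    a + rotate k u d               <⟨ +-monoʳ-< a (rotate-< k u d) ⟩
    a + L                          ≡⟨ blockRotation-above u ≤-refl ⟨
    blockRotation u (a + L)        ≡⟨ cong (λ x → blockRotation u (a + x)) sd≡L ⟨
    blockRotation u (a + suc d)    ≡⟨ cong (blockRotation u) (+-suc a d) ⟩
    blockRotation u (suc (a + d))  ∎
    where
    open ≤-Reasoning
    sd≡L : suc d ≡ L
    sd≡L = ≤-antisym d<L (≮⇒≥ sd≮L)

  blockRotation-ascent : ∀ {u} → u < L → ∀ i → i ≢ descentPosition u →
    blockRotation u i < blockRotation u (suc i)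
  blockRotation-ascent {u} u<L i i≢p with position i
  ... | inside d<L = blockRotation-ascent-block u<L d<L i≢p
  ... | outside y with y <? a
  ...   | yes y<a = subst (λ x → blockRotation u x < blockRotation u (suc x)) (sym (skip-below y<a))
                      (blockRotation-ascent-below u y<a)
  ...   | no  y≮a = blockRotation-ascent-above u
                      (subst (a + L ≤_) (sym (skip-above (≮⇒≥ y≮a))) (+-monoˡ-≤ L (≮⇒≥ y≮a)))

module BoundedSplice (a k : ℕ) {j n : ℕ} (j+L≡n : j + suc k ≡ n) (a≤j : a ≤ j) where

  open Splice a k

  private
    L = suc k

  skip-< : ∀ {y} → y < j → skip y < n
  skip-< {y} y<j with y <? a
  ... | yes y<a = subst₂ _<_ (sym (skip-below y<a)) j+L≡n (<-≤-trans y<j (m≤m+n j L))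
  ... | no  y≮a = subst₂ _<_ (sym (skip-above (≮⇒≥ y≮a))) j+L≡n (+-monoˡ-< L y<j)

  skip-<⁻¹ : ∀ {y} → skip y < n → y < j
  skip-<⁻¹ {y} skip<n with y <? a
  ... | yes y<a = <-≤-trans y<a a≤j
  ... | no  y≮a = +-cancelʳ-< L y j (subst₂ _<_ (skip-above (≮⇒≥ y≮a)) (sym j+L≡n) skip<n)

  block-< : ∀ {d} → d < L → a + d < n
  block-< d<L = subst (_ <_) j+L≡n (+-mono-≤-< a≤j d<L)

  splice-mapsBelow : ∀ T r → MapsBelow j T → MapsBelow n (splice T r)
  splice-mapsBelow T r T<j {x} x<n with position x
  ... | outside y      = subst (_< n) (sym (splice-skip T r y)) (skip-< (T<j (skip-<⁻¹ x<n)))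
  ... | inside {d} d<L = subst (_< n) (sym (splice-block T r d<L)) (block-< (rotate-< k r d))

  splice-cong : ∀ T S r → (∀ {y} → y < j → T y ≡ S y) → ∀ {x} → x < n → splice T r x ≡ splice S r x
  splice-cong T S r T≗S {x} x<n with position x
  ... | outside y  = trans (splice-skip T r y) (trans (cong skip (T≗S (skip-<⁻¹ x<n))) (sym (splice-skip S r y)))
  ... | inside d<L = trans (splice-block T r d<L) (sym (splice-block S r d<L))

  splice-square : ∀ T s r → InvolutiveBelow j T → ∀ {x} → x < n →
    splice T s (splice T r x) ≡ blockRotation (rotate k s r) x
  splice-square T s r T²≡id {x} x<n = trans (splice-∘ T T s r x) (splice-cong (T ∘ T) id (rotate k s r) T²≡id x<n)

  splice-injective : ∀ T {r} → r ≤ L → InvolutiveBelow j T →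
    ∀ {x y} → x < n → y < n → splice T r x ≡ splice T r y → x ≡ y
  splice-injective T {r} r≤L T²≡id {x} {y} x<n y<n eq = begin
    x                                ≡⟨ unsplice x<n ⟨
    splice T (L ∸ r) (splice T r x)  ≡⟨ cong (splice T (L ∸ r)) eq ⟩
    splice T (L ∸ r) (splice T r y)  ≡⟨ unsplice y<n ⟩
    y                                ∎
    where
    open ≡-Reasoning
    unsplice : ∀ {z} → z < n → splice T (L ∸ r) (splice T r z) ≡ z
    unsplice {z} z<n = trans (splice-square T (L ∸ r) r T²≡id z<n)
      (trans (cong (λ u → blockRotation u z) (rotate-inverse k r≤L)) (blockRotation-zero z))

  blockRotation-descents : ∀ {u} → 0 < u → u < L → descentsUpTo (blockRotation u) (pred n) ≡ 1
  blockRotation-descents {u} 0<u u<L = descentsUpTo-≡1 (blockRotation u) (pred n) (descentPosition u)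
    (<⇒≤pred (subst (_< n) (+-suc a (k ∸ u)) (block-< (s<s (∸-monoʳ-< 0<u (s≤s⁻¹ u<L))))))
    (blockRotation-descent 0<u u<L) (λ i _ → blockRotation-ascent u<L i)

  splice-determines-shift : ∀ T T′ {r r′} → r < L → r′ < L →
    (∀ {x} → x < n → splice T r x ≡ splice T′ r′ x) → r ≡ r′
  splice-determines-shift T T′ {r} {r′} r<L r′<L agree = +-cancelˡ-≡ a r r′ (begin
    a + r                 ≡⟨ cong (a +_) (rotate-small k r 0 r<L) ⟨
    a + rotate k r 0      ≡⟨ splice-block T r z<s ⟨
    splice T r (a + 0)    ≡⟨ agree (block-< z<s) ⟩
    splice T′ r′ (a + 0)  ≡⟨ splice-block T′ r′ z<s ⟩
    a + rotate k r′ 0     ≡⟨ cong (a +_) (rotate-small k r′ 0 r′<L) ⟩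
    a + r′                ∎)
    where open ≡-Reasoning

  splice-determines-outside : ∀ T T′ {r r′} → (∀ {x} → x < n → splice T r x ≡ splice T′ r′ x) →
    ∀ {y} → y < j → T y ≡ T′ y
  splice-determines-outside T T′ {r} {r′} agree {y} y<j = skip-injective (begin
    skip (T y)             ≡⟨ splice-skip T r y ⟨
    splice T r (skip y)    ≡⟨ agree (skip-< y<j) ⟩
    splice T′ r′ (skip y)  ≡⟨ splice-skip T′ r′ y ⟩
    skip (T′ y)            ∎)
    where open ≡-Reasoning

-- The block of a non-trivial block rotation is its set of moved points.
blockRotation-block-⊆ : ∀ {a k u a′ k′ u′ n} → 0 < u → u < suc k → a + k < n →
  (∀ {x} → x < n → Splice.blockRotation a k u x ≡ Splice.blockRotation a′ k′ u′ x) →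
  a′ ≤ a × a + k < a′ + suc k′
blockRotation-block-⊆ {a} {k} {u} {a′} {k′} {u′} {n} 0<u u<L a+k<n agree =
  subst (a′ ≤_) (+-identityʳ a) (proj₁ (moved′ (≤-<-trans (+-monoʳ-≤ a z≤n) a+k<n) z<s)) ,
  proj₂ (moved′ a+k<n (n<1+n k))
  where
  moved′ : ∀ {d} → a + d < n → d < suc k → a′ ≤ a + d × a + d < a′ + suc k′
  moved′ a+d<n d<L = Splice.moved⇒inBlock a′ k′ u′ λ fixed′ →
    Splice.inBlock⇒moved a k 0<u u<L d<L (trans (agree a+d<n) fixed′)

blockRotation-determines-block : ∀ {a k u a′ k′ u′ n} → 0 < u → u < suc k → 0 < u′ → u′ < suc k′ →
  a + k < n → a′ + k′ < n →
  (∀ {x} → x < n → Splice.blockRotation a k u x ≡ Splice.blockRotation a′ k′ u′ x) →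
  a ≡ a′ × k ≡ k′
blockRotation-determines-block {a} {k} {u} {a′} {k′} 0<u u<L 0<u′ u′<L′ a+k<n a′+k′<n agree =
  a≡a′ , ≤-antisym (s≤s⁻¹ (+-cancelˡ-< a _ _ (subst (λ b → a + k < b + suc k′) (sym a≡a′) (proj₂ forth))))
                   (s≤s⁻¹ (+-cancelˡ-< a _ _ (subst (λ b → b + k′ < a + suc k) (sym a≡a′) (proj₂ back))))
  where
  forth = blockRotation-block-⊆ 0<u u<L a+k<n agree
  back  = blockRotation-block-⊆ 0<u′ u′<L′ a′+k′<n (sym ∘ agree)
  a≡a′ = ≤-antisym (proj₁ back) (proj₁ forth)

spliced : (n a k r : ℕ) {j : ℕ} → Vec (Fin j) j → Vec (Fin n) n
spliced n a k r τ = fromFunction n (Splice.splice a k (lookupℕ τ) r)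

record Admissible (n a k r : ℕ) {j : ℕ} (τ : Vec (Fin j) j) : Set where
  field
    j+L≡n        : j + suc k ≡ n
    a≤j          : a ≤ j
    τ-involutive : ∀ i → lookup τ (lookup τ i) ≡ i
    r<L          : r < suc k
    0<2r         : 0 < rotate k r r

spliced-∈-SqOneDescent : ∀ {n a k r j} {τ : Vec (Fin j) j} → Admissible n a k r τ →
  spliced n a k r τ ∈ SqOneDescent n
spliced-∈-SqOneDescent {n} {a} {k} {r} {j} {τ} adm =
  ∈-filter⁺ _ (∈-Perms (fromFunction-Unique π<n (splice-injective t (<⇒≤ r<L) t²≡id))) (begin
    descents (toList (square (spliced n a k r τ)))        ≡⟨ descents-square-fromFunction π<n ⟩
    descentsUpTo (splice t r ∘ splice t r) (pred n)       ≡⟨ descentsUpTo-cong (pred n) (π² ∘ ≤pred⇒<) ⟩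
    descentsUpTo (blockRotation (rotate k r r)) (pred n)  ≡⟨ blockRotation-descents 0<2r (rotate-< k r r) ⟩
    1                                                     ∎)
  where
  open ≡-Reasoning
  open Admissible adm
  open Splice a k
  open BoundedSplice a k j+L≡n a≤j
  t = lookupℕ τ
  π<n = splice-mapsBelow t r (lookupℕ-< τ)
  t²≡id = lookupℕ-involutive τ τ-involutive
  π² = splice-square t r r t²≡id
  ≤pred⇒< : ∀ {i} → i ≤ pred n → i < n
  ≤pred⇒< = m≤pred[n]⇒suc[m]≤n {{>-nonZero (≤-<-trans z≤n (block-< z<s))}}

spliced-determines-block : ∀ {n a k r j a′ k′ r′ j′} {τ : Vec (Fin j) j} {τ′ : Vec (Fin j′) j′} →
  Admissible n a k r τ → Admissible n a′ k′ r′ τ′ → spliced n a k r τ ≡ spliced n a′ k′ r′ τ′ →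
  a ≡ a′ × k ≡ k′
spliced-determines-block {n} {a} {k} {r} {j} {a′} {k′} {r′} {j′} {τ} {τ′} adm adm′ eq =
  blockRotation-determines-block A.0<2r (rotate-< k r r) A′.0<2r (rotate-< k′ r′ r′)
    (S.block-< (n<1+n k)) (S′.block-< (n<1+n k′)) squares-agree
  where
  module A  = Admissible adm
  module A′ = Admissible adm′
  module S  = BoundedSplice a k A.j+L≡n A.a≤j
  module S′ = BoundedSplice a′ k′ A′.j+L≡n A′.a≤j
  π π′ : ℕ → ℕ
  π  = Splice.splice a k (lookupℕ τ) r
  π′ = Splice.splice a′ k′ (lookupℕ τ′) r′
  π<n  = S.splice-mapsBelow (lookupℕ τ) r (lookupℕ-< τ)
  π′<n = S′.splice-mapsBelow (lookupℕ τ′) r′ (lookupℕ-< τ′)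
  agree : ∀ {x} → x < n → π x ≡ π′ x
  agree = fromFunction-injective π<n π′<n eq
  squares-agree : ∀ {x} → x < n →
    Splice.blockRotation a k (rotate k r r) x ≡ Splice.blockRotation a′ k′ (rotate k′ r′ r′) x
  squares-agree {x} x<n = begin
    Splice.blockRotation a k (rotate k r r) x       ≡⟨ π² x<n ⟨
    π (π x)                                         ≡⟨ trans (agree (π<n x<n)) (cong π′ (agree x<n)) ⟩
    π′ (π′ x)                                       ≡⟨ π′² x<n ⟩
    Splice.blockRotation a′ k′ (rotate k′ r′ r′) x  ∎
    where
    open ≡-Reasoning
    π²  = S.splice-square (lookupℕ τ) r r (lookupℕ-involutive τ A.τ-involutive)
    π′² = S′.splice-square (lookupℕ τ′) r′ r′ (lookupℕ-involutive τ′ A′.τ-involutive)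

module _ {n a k j : ℕ} (j+L≡n : j + suc k ≡ n) (a≤j : a ≤ j) where

  open BoundedSplice a k j+L≡n a≤j

  private
    splice-agree : ∀ {r r′} {τ τ′ : Vec (Fin j) j} → spliced n a k r τ ≡ spliced n a k r′ τ′ →
      ∀ {x} → x < n → Splice.splice a k (lookupℕ τ) r x ≡ Splice.splice a k (lookupℕ τ′) r′ x
    splice-agree {r} {r′} {τ} {τ′} =
      fromFunction-injective (splice-mapsBelow (lookupℕ τ) r (lookupℕ-< τ))
                             (splice-mapsBelow (lookupℕ τ′) r′ (lookupℕ-< τ′))

  spliced-determines-shift : ∀ {r r′} {τ τ′ : Vec (Fin j) j} → r < suc k → r′ < suc k →
    spliced n a k r τ ≡ spliced n a k r′ τ′ → r ≡ r′
  spliced-determines-shift {r} {r′} {τ} {τ′} r<L r′<L eq =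
    splice-determines-shift (lookupℕ τ) (lookupℕ τ′) r<L r′<L (splice-agree {r} {r′} {τ} {τ′} eq)

  spliced-injectiveʳ : ∀ {r} {τ τ′ : Vec (Fin j) j} → spliced n a k r τ ≡ spliced n a k r τ′ → τ ≡ τ′
  spliced-injectiveʳ {r} {τ} {τ′} eq =
    lookupℕ-injective τ τ′ (splice-determines-outside (lookupℕ τ) (lookupℕ τ′) (splice-agree {r} {r} {τ} {τ′} eq))

-- Counting

-- The r ∈ [1, k] with 2r ≢ 0 (mod k + 1): all of them for even k, all but (k + 1)/2 for odd k.
shifts : ℕ → List ℕ
shifts k = map suc (upTo (k / 2)) ++ map (λ i → suc (i + (k ∸ k / 2))) (upTo (k / 2))

module _ (k : ℕ) where

  private
    h = k / 2
    m = k ∸ k / 2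

    h+m≡k : h + m ≡ k
    h+m≡k = m+[n∸m]≡n (m/n≤m k 2)

    h+h≤k : h + h ≤ k
    h+h≤k = subst (_≤ k) (trans (*-comm h 2) (cong (h +_) (+-identityʳ h))) (m/n*n≤m k 2)

    h≤m : h ≤ m
    h≤m = +-cancelˡ-≤ h h m (subst (h + h ≤_) (sym h+m≡k) h+h≤k)

    k≤m+m : k ≤ m + m
    k≤m+m = subst (_≤ m + m) h+m≡k (+-monoˡ-≤ m h≤m)

  length-shifts : length (shifts k) ≡ h + h
  length-shifts = trans (length-++ (map suc (upTo h)))
    (cong₂ _+_ (trans (length-map suc (upTo h)) (length-upTo h))
               (trans (length-map (λ i → suc (i + m)) (upTo h)) (length-upTo h)))

  shifts-Unique : Unique (shifts k)
  shifts-Unique = Unique.++⁺ (Unique.map⁺ suc-injective (Unique.upTo⁺ h))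
    (Unique.map⁺ (+-cancelʳ-≡ m _ _ ∘ suc-injective) (Unique.upTo⁺ h)) disjoint
    where
    disjoint : ∀ {r} → ¬ (r ∈ map suc (upTo h) × r ∈ map (λ i → suc (i + m)) (upTo h))
    disjoint (p , q) with ∈-map⁻ suc p | ∈-map⁻ _ q
    ... | i , i∈ , refl | i′ , _ , eq =
      <⇒≱ (∈-upTo⁻ i∈) (≤-trans h≤m (subst (m ≤_) (sym (suc-injective eq)) (m≤n+m m i′)))

  ∈-shifts⁻ : ∀ {r} → r ∈ shifts k → r < suc k × 0 < rotate k r r
  ∈-shifts⁻ r∈ with ∈-++⁻ (map suc (upTo h)) r∈
  ... | inj₁ p with ∈-map⁻ suc p
  ...   | i , i∈ , refl = r<L , rotate-twice-nonzero k z<s r<L (<⇒≢ (s<s (≤-trans (+-mono-≤ i<h i<h) h+h≤k)))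
    where
    i<h = ∈-upTo⁻ i∈
    r<L = s<s (<-≤-trans i<h (m/n≤m k 2))
  ∈-shifts⁻ r∈ | inj₂ q with ∈-map⁻ _ q
  ... | i , i∈ , refl = r<L , rotate-twice-nonzero k z<s r<L (>⇒≢ L<2r)
    where
    r<L = s<s (subst (i + m <_) h+m≡k (+-monoˡ-< m (∈-upTo⁻ i∈)))
    L<2r : suc k < suc (i + m) + suc (i + m)
    L<2r = subst (suc k <_) (cong suc (sym (+-suc (i + m) (i + m))))
      (s<s (s<s (≤-trans k≤m+m (+-mono-≤ (m≤n+m m i) (m≤n+m m i)))))

blockSizes : ℕ → List ℕ
blockSizes n = map (λ i → i + 2) (upTo (n ∸ 2))

blockSizes-< : ∀ {n k} → k ∈ blockSizes n → k < n
blockSizes-< {suc (suc n)} k∈ with ∈-map⁻ (λ i → i + 2) k∈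
... | i , i∈ , refl = subst (_< suc (suc n)) (+-comm 2 i) (s<s (s<s (∈-upTo⁻ i∈)))

blockSizes-Unique : ∀ n → Unique (blockSizes n)
blockSizes-Unique n = Unique.map⁺ (+-cancelʳ-≡ 2 _ _) (Unique.upTo⁺ (n ∸ 2))

module _ {n k : ℕ} (k<n : k < n) where

  complement+block≡n : n ∸ (k + 1) + suc k ≡ n
  complement+block≡n = trans (cong (n ∸ (k + 1) +_) (+-comm 1 k)) (m∸n+n≡m (subst (_≤ n) (+-comm 1 k) k<n))

  start≤complement : ∀ {a} → a < n ∸ k → a ≤ n ∸ (k + 1)
  start≤complement {a} a< = subst (a ≤_) (trans (pred[m∸n]≡m∸[1+n] n k) (cong (n ∸_) (+-comm 1 k))) (<⇒≤pred a<)

  admissible : ∀ {a r} {τ : Vec (Fin (n ∸ (k + 1))) (n ∸ (k + 1))} → a < n ∸ k → r ∈ shifts k →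
    τ ∈ Involutions (n ∸ (k + 1)) → Admissible n a k r τ
  admissible a< r∈ τ∈ = record
    { j+L≡n        = complement+block≡n
    ; a≤j          = start≤complement a<
    ; τ-involutive = ∈-Involutions⇒involutive τ∈
    ; r<L          = proj₁ (∈-shifts⁻ k r∈)
    ; 0<2r         = proj₂ (∈-shifts⁻ k r∈)
    }

splicedAt : (n k a : ℕ) → List (Vec (Fin n) n)
splicedAt n k a = concatMap (λ r → map (spliced n a k r) (Involutions (n ∸ (k + 1)))) (shifts k)

splicedOfSize : (n k : ℕ) → List (Vec (Fin n) n)
splicedOfSize n k = concatMap (splicedAt n k) (upTo (n ∸ k))

allSpliced : (n : ℕ) → List (Vec (Fin n) n)
allSpliced n = concatMap (splicedOfSize n) (blockSizes n)

SplicedWith : (n k a : ℕ) → Vec (Fin n) n → Set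
SplicedWith n k a π = Σ[ r ∈ ℕ ] Σ[ τ ∈ Vec (Fin (n ∸ (k + 1))) (n ∸ (k + 1)) ]
  Admissible n a k r τ × π ≡ spliced n a k r τ

SplicedWith-block : ∀ {n k a k′ a′ π} → SplicedWith n k a π → SplicedWith n k′ a′ π → a ≡ a′ × k ≡ k′
SplicedWith-block (_ , _ , adm , refl) (_ , _ , adm′ , eq) = spliced-determines-block adm adm′ eq

module _ {n k : ℕ} (k<n : k < n) where

  ∈-splicedAt⁻ : ∀ {a π} → a < n ∸ k → π ∈ splicedAt n k a → SplicedWith n k a π
  ∈-splicedAt⁻ {a} a< π∈
    with find (∈-concatMap⁻ (λ r → map (spliced n a k r) (Involutions (n ∸ (k + 1)))) {xs = shifts k} π∈)
  ... | r , r∈ , π∈′ with ∈-map⁻ (spliced n a k r) π∈′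
  ...   | τ , τ∈ , π≡ = r , τ , admissible k<n a< r∈ τ∈ , π≡

  ∈-splicedOfSize⁻ : ∀ {π} → π ∈ splicedOfSize n k → ∃[ a ] SplicedWith n k a π
  ∈-splicedOfSize⁻ π∈ with find (∈-concatMap⁻ (splicedAt n k) {xs = upTo (n ∸ k)} π∈)
  ... | a , a∈ , π∈′ = a , ∈-splicedAt⁻ (∈-upTo⁻ a∈) π∈′

  splicedAt-Unique : ∀ {a} → a < n ∸ k → Unique (splicedAt n k a)
  splicedAt-Unique {a} a< = Unique-concatMap _ (shifts-Unique k)
    (λ _ → Unique.map⁺ (spliced-injectiveʳ j+L≡n a≤j) (Involutions-Unique _)) same-shift
    where
    j+L≡n = complement+block≡n k<n
    a≤j = start≤complement k<n a<
    same-shift : ∀ {r r′ π} → r ∈ shifts k → r′ ∈ shifts k →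
      π ∈ map (spliced n a k r) (Involutions (n ∸ (k + 1))) →
      π ∈ map (spliced n a k r′) (Involutions (n ∸ (k + 1))) → r ≡ r′
    same-shift r∈ r′∈ p q with ∈-map⁻ _ p | ∈-map⁻ _ q
    ... | τ , _ , refl | τ′ , _ , eq =
      spliced-determines-shift j+L≡n a≤j {τ = τ} {τ′} (proj₁ (∈-shifts⁻ k r∈)) (proj₁ (∈-shifts⁻ k r′∈)) eq

  splicedOfSize-Unique : Unique (splicedOfSize n k)
  splicedOfSize-Unique = Unique-concatMap (splicedAt n k) (Unique.upTo⁺ (n ∸ k))
    (splicedAt-Unique ∘ ∈-upTo⁻) λ a∈ a′∈ p q →
      proj₁ (SplicedWith-block (∈-splicedAt⁻ (∈-upTo⁻ a∈) p) (∈-splicedAt⁻ (∈-upTo⁻ a′∈) q))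

allSpliced-Unique : ∀ n → Unique (allSpliced n)
allSpliced-Unique n = Unique-concatMap (splicedOfSize n) (blockSizes-Unique n)
  (splicedOfSize-Unique ∘ blockSizes-<) same-size
  where
  same-size : ∀ {k k′ π} → k ∈ blockSizes n → k′ ∈ blockSizes n →
    π ∈ splicedOfSize n k → π ∈ splicedOfSize n k′ → k ≡ k′
  same-size k∈ k′∈ p q = proj₂ (SplicedWith-block (proj₂ (∈-splicedOfSize⁻ (blockSizes-< k∈) p))
                                                  (proj₂ (∈-splicedOfSize⁻ (blockSizes-< k′∈) q)))

SplicedWith⇒∈ : ∀ {n k a π} → SplicedWith n k a π → π ∈ SqOneDescent n
SplicedWith⇒∈ (_ , _ , adm , refl) = spliced-∈-SqOneDescent adm

allSpliced-⊆ : ∀ n → allSpliced n ⊆ SqOneDescent n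
allSpliced-⊆ n π∈ with find (∈-concatMap⁻ (splicedOfSize n) {xs = blockSizes n} π∈)
... | k , k∈ , π∈′ = SplicedWith⇒∈ (proj₂ (∈-splicedOfSize⁻ (blockSizes-< k∈) π∈′))

length-splicedOfSize : ∀ n k → length (splicedOfSize n k) ≡ 2 * (k / 2) * (n ∸ k) * involutions (n ∸ (k + 1))
length-splicedOfSize n k = begin
  length (splicedOfSize n k)                       ≡⟨ length-concatMap-const _ (upTo (n ∸ k)) length-splicedAt ⟩
  length (upTo (n ∸ k)) * (length (shifts k) * e)  ≡⟨ cong₂ (λ x y → x * (y * e)) (length-upTo (n ∸ k)) (length-shifts k) ⟩
  (n ∸ k) * ((k / 2 + k / 2) * e)                  ≡⟨ solve 3 (λ m h e → m :* ((h :+ h) :* e) := con 2 :* h :* m :* e)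
                                                              refl (n ∸ k) (k / 2) e ⟩
  2 * (k / 2) * (n ∸ k) * e                        ∎
  where
  open ≡-Reasoning
  open +-*-Solver
  e = involutions (n ∸ (k + 1))
  length-splicedAt : ∀ a → length (splicedAt n k a) ≡ length (shifts k) * e
  length-splicedAt a = length-concatMap-const _ (shifts k) λ r → length-map (spliced n a k r) (Involutions (n ∸ (k + 1)))

length-allSpliced : ∀ n → length (allSpliced n) ≡ lowerBound n
length-allSpliced n = trans (length-concatMap (splicedOfSize n) (blockSizes n))
  (cong sum (map-cong (length-splicedOfSize n) (blockSizes n)))

lowerBound≤countSqOneDescent : ∀ n → lowerBound n ≤ countSqOneDescent n
lowerBound≤countSqOneDescent n = begin
  lowerBound n                ≡⟨ length-allSpliced n ⟨
  length (allSpliced n)       ≤⟨ Unique⇒length≤ (allSpliced-Unique n) (allSpliced-⊆ n) ⟩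
  length (SqOneDescent n)     ∎
  where open ≤-Reasoning

proposition4p9 : (n : ℕ) → 3 ≤ n → lowerBound n ≤ countSqOneDescent n
proposition4p9 n _ = lowerBound≤countSqOneDescent n
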